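{- For every integer $n \ge 4$, the sequence $(JL_{n,k})_{k \ge 0}$ is strictly increasing to the left of its mode $k^* = \lfloor \frac{n-4}{6} \rfloor + 1$, i.e. $JL_{n,0} < JL_{n,1} < \cdots < JL_{n,k^*}$.
   Context: For integers $n \ge 1$ and $k \ge 0$, $JL_{n,k} = \sum_{i=k}^{\lfloor n/2 \rfloor} \frac{n}{n-i} \binom{n-i}{i} \binom{i}{k}$, where an empty sum equals $0$. -}

module Defs where

open import Data.Nat using (ℕ; zero; suc; _+_; _*_; _∸_; _/_)
open import Data.Nat.Combinatorics using (_C_)
open import Data.List using (List; map; upTo; foldr)
open import Data.Integer using (+_)
open import Data.Rational using (ℚ; 0ℚ) renaming (_+_ to _+ℚ_; _/_ to _/ℚ_)

-- Σ_{i = a}^{b} f i  (empty, i.e. 0, when b < a)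
sumFromTo : ℕ → ℕ → (ℕ → ℚ) → ℚ
sumFromTo a b f = foldr _+ℚ_ 0ℚ (map (λ j → f (a + j)) (upTo (suc b ∸ a)))

-- the rational number  n / (n - i) * C(n-i, i) * C(i, k)
-- (the denominator n - i is ≥ 1 throughout the summation range since i ≤ ⌊n/2⌋, n ≥ 1;
--  the zero-denominator branch is never used there)
JLterm : ℕ → ℕ → ℕ → ℚ
JLterm n k i with n ∸ i
... | zero  = 0ℚ
... | suc d = (+ (n * ((n ∸ i) C i) * (i C k))) /ℚ (suc d)

JL : ℕ → ℕ → ℚ
JL n k = sumFromTo k (n / 2) (JLterm n k)

-- Σᵢ n/(n - i) C(n - i, i) xⁱ is the Lucas polynomial Lₙ(x), so JL n k is the coefficient ℓ(n, k) of yᵏ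
-- in Lₙ(1 + y), a natural number.  Since Lₙ₊₂ = Lₙ₊₁ + x Lₙ, ℓ(n + 2, k) = ℓ(n + 1, k) + ℓ(n, k) + ℓ(n, k - 1),
-- so ℓ(n, k) < ℓ(n, k + 1) passes from n and n + 1 to n + 2, and only n = 6k + 4 and n = 6k + 5 need an
-- argument.  There, with F(s, N) = [z^N] (1 - z - z²)^(-s), the claim reduces to
-- F(k + 1, 4k + 4) / F(k + 1, 4k + 3) > 2 - 1 / (2k + 2).  This is proved in the stronger form
-- ≥ 2 - 9 / (20k + 20) by induction on k: an interval for the ratio of consecutive coefficients is pushed
-- along the three-term recurrence in N and across one step s ↦ s + 1, both obtained by differentiating
-- (1 - z - z²)^(-s).

module Submission where

open import Defs
open import Data.Nat using (ℕ; _≤_; _<_; _/_; _∸_; _+_)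
open import Data.Rational using () renaming (_<_ to _<ℚ_)

open import Data.Nat using (zero; suc; _*_; z≤n; s≤s; _<?_; NonZero; _%_; ≢-nonZero)
open import Data.Nat.Properties
open import Data.Nat.Combinatorics using (_C_; k>n⇒nCk≡0; nCk+nC[k+1]≡[n+1]C[k+1])
open import Data.Nat.DivMod using (m≡m%n+[m/n]*n; m%n<n; /-monoˡ-≤; m*n/n≡m; m/n<m; m/n≤m; m/n*n≤m)
open import Data.Nat.Coprimality using (1-coprimeTo) renaming (sym to coprime-sym)
open import Data.Nat.GCD using (gcd; gcd[m,n]≢0)
open import Data.Nat.Tactic.RingSolver using (solve-∀)
import Data.Integer as ℤ
import Data.Integer.Properties as ℤ
open import Data.Rational as ℚ using (ℚ; mkℚ; 0ℚ; *≡*; *<*; ↥_; ↧_)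
import Data.Rational.Properties as ℚ
open import Data.List using (map; foldr; applyUpTo)
open import Data.Product using (_×_; _,_; proj₁; proj₂)
open import Data.Sum using (inj₁; inj₂)
open import Relation.Binary.PropositionalEquality
open import Relation.Nullary using (yes; no)

cancel-≡-summands : ∀ {l r a b} → a ≡ b → l + b ≡ r + a → l ≡ r
cancel-≡-summands {l} {r} {a} {b} a≡b eq = +-cancelʳ-≡ b l r (trans eq (cong (r +_) a≡b))

≤-by-slack : ∀ {l r s} → r ≡ l + s → l ≤ r
≤-by-slack {l} {s = s} r≡l+s = subst (l ≤_) (sym r≡l+s) (m≤m+n l s)

+-nonZeroˡ : ∀ m n .{{_ : NonZero m}} → NonZero (m + n)
+-nonZeroˡ (suc m) n = _

+-nonZeroʳ : ∀ m n .{{_ : NonZero n}} → NonZero (m + n)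
+-nonZeroʳ m n = subst NonZero (+-comm n m) (+-nonZeroˡ n m)

∸-<-half : ∀ {m i} → m < i + i → m ∸ i < i
∸-<-half {m} {suc i} lt = m<n+o⇒m∸n<o m (suc i) lt

half-< : ∀ n i → n / 2 < i → n < i + i
half-< n i n/2<i = begin-strict
  n                          ≡⟨ m≡m%n+[m/n]*n n 2 ⟩
  n % 2 + n / 2 * 2          <⟨ +-monoˡ-< (n / 2 * 2) (m%n<n n 2) ⟩
  2 + n / 2 * 2              ≡⟨ double (n / 2) ⟩
  suc (n / 2) + suc (n / 2)  ≤⟨ +-mono-≤ n/2<i n/2<i ⟩
  i + i                      ∎
  where
  open ≤-Reasoning
  double : ∀ h → 2 + h * 2 ≡ suc h + suc h
  double = solve-∀

∸1-< : ∀ {a b} → a < suc b → 0 < b → a ∸ 1 < b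
∸1-< {zero}  _         0<b = 0<b
∸1-< {suc a} (s≤s a<b) _   = a<b

+-cong₃ : ∀ {a a′ b b′ c c′ : ℕ} → a ≡ a′ → b ≡ b′ → c ≡ c′ → a + b + c ≡ a′ + b′ + c′
+-cong₃ refl refl refl = refl

<-from-balance : ∀ q {a b x y} .{{_ : NonZero q}} → q * a + x ≡ q * b + y → y < x → a < b
<-from-balance q {a} {b} {x} {y} balance y<x = *-cancelˡ-< q a b (+-cancelʳ-< x (q * a) (q * b) (begin-strict
  q * a + x  ≡⟨ balance ⟩
  q * b + y  <⟨ +-monoʳ-< (q * b) y<x ⟩
  q * b + x  ∎))
  where open ≤-Reasoning

binom : ℕ → ℕ → ℕ
binom n       zero    = 1
binom zero    (suc k) = 0
binom (suc n) (suc k) = binom n k + binom n (suc k)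

C≡binom : ∀ n k → n C k ≡ binom n k
C≡binom n       zero    = refl
C≡binom zero    (suc k) = k>n⇒nCk≡0 {0} {suc k} (s≤s z≤n)
C≡binom (suc n) (suc k) = begin
  suc n C suc k             ≡⟨ nCk+nC[k+1]≡[n+1]C[k+1] n k ⟨
  n C k + n C suc k         ≡⟨ cong₂ _+_ (C≡binom n k) (C≡binom n (suc k)) ⟩
  binom (suc n) (suc k)     ∎
  where open ≡-Reasoning

binom-≡0 : ∀ {n k} → n < k → binom n k ≡ 0
binom-≡0 {zero}  {suc k} _         = refl
binom-≡0 {suc n} {suc k} (s≤s n<k) = cong₂ _+_ (binom-≡0 n<k) (binom-≡0 (m<n⇒m<1+n n<k))

binom-1 : ∀ n → binom n 1 ≡ n
binom-1 zero    = refl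
binom-1 (suc n) = cong suc (binom-1 n)

binom-absorb : ∀ d i → suc i * binom (suc d) (suc i) ≡ suc d * binom d i
binom-absorb d       zero    = trans (+-identityʳ _) (trans (binom-1 (suc d)) (sym (*-identityʳ (suc d))))
binom-absorb zero    (suc i) = *-zeroʳ (suc (suc i))
binom-absorb (suc d) (suc i) = begin
  (2 + i) * (b (suc i) + b (2 + i))                      ≡⟨ regroup i (b (suc i)) (b (2 + i)) ⟩
  suc i * b (suc i) + (2 + i) * b (2 + i) + b (suc i)    ≡⟨ cong (_+ b (suc i)) (cong₂ _+_ (binom-absorb d i) (binom-absorb d (suc i))) ⟩
  suc d * binom d i + suc d * binom d (suc i) + b (suc i) ≡⟨ cong (_+ b (suc i)) (*-distribˡ-+ (suc d) (binom d i) (binom d (suc i))) ⟨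
  suc d * b (suc i) + b (suc i)                          ≡⟨ +-comm (suc d * b (suc i)) (b (suc i)) ⟩
  (2 + d) * b (suc i)                                    ∎
  where
  open ≡-Reasoning
  b : ℕ → ℕ
  b = binom (suc d)
  regroup : ∀ i x y → (2 + i) * (x + y) ≡ suc i * x + (2 + i) * y + x
  regroup = solve-∀

-- If f lists the coefficients of p(y), then shift f lists those of y p(y).
shift : (ℕ → ℕ) → ℕ → ℕ
shift f zero    = 0
shift f (suc k) = f k

binom-suc : ∀ j k → binom (suc j) k ≡ binom j k + shift (binom j) k
binom-suc j zero    = refl
binom-suc j (suc k) = +-comm (binom j k) (binom j (suc k))

binom-absorb-shift : ∀ m i → i * binom m i ≡ m * shift (binom (m ∸ 1)) i
binom-absorb-shift m       zero    = sym (*-zeroʳ m)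
binom-absorb-shift zero    (suc i) = *-zeroʳ (suc i)
binom-absorb-shift (suc m) (suc i) = binom-absorb m i

binom-∸-suc : ∀ m j l → j ≤ l → binom (suc m ∸ j) (suc l) ≡ binom (m ∸ j) (suc l) + binom (m ∸ j) l
binom-∸-suc m       zero    l       _         = +-comm (binom m l) (binom m (suc l))
binom-∸-suc zero    (suc j) (suc l) _         rewrite 0∸n≡0 j = refl
binom-∸-suc (suc m) (suc j) l       (s≤s j≤l) = binom-∸-suc m j l (m≤n⇒m≤1+n j≤l)

∑< : ℕ → (ℕ → ℕ) → ℕ
∑< zero    f = 0
∑< (suc L) f = f 0 + ∑< L (λ j → f (suc j))

∑<-cong : ∀ L {f g} → (∀ j → j < L → f j ≡ g j) → ∑< L f ≡ ∑< L g
∑<-cong zero    eq = refl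
∑<-cong (suc L) eq = cong₂ _+_ (eq 0 (s≤s z≤n)) (∑<-cong L (λ j j<L → eq (suc j) (s≤s j<L)))

∑<-zero : ∀ L {f} → (∀ j → j < L → f j ≡ 0) → ∑< L f ≡ 0
∑<-zero zero    _  = refl
∑<-zero (suc L) eq = cong₂ _+_ (eq 0 (s≤s z≤n)) (∑<-zero L (λ j j<L → eq (suc j) (s≤s j<L)))

∑<-distrib-+ : ∀ L f g → ∑< L (λ j → f j + g j) ≡ ∑< L f + ∑< L g
∑<-distrib-+ zero    f g = refl
∑<-distrib-+ (suc L) f g = trans (cong (f 0 + g 0 +_) (∑<-distrib-+ L _ _)) (+-interchange (f 0) (g 0) _ _)
  where
  +-interchange : ∀ a b c d → a + b + (c + d) ≡ a + c + (b + d)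
  +-interchange = solve-∀

∑<-snoc : ∀ L f → ∑< (suc L) f ≡ ∑< L f + f L
∑<-snoc zero    f = +-identityʳ (f 0)
∑<-snoc (suc L) f = trans (cong (f 0 +_) (∑<-snoc L _)) (sym (+-assoc (f 0) _ _))

∑<-snoc-0 : ∀ L f → f L ≡ 0 → ∑< (suc L) f ≡ ∑< L f
∑<-snoc-0 L f fL≡0 = trans (∑<-snoc L f) (trans (cong (∑< L f +_) fL≡0) (+-identityʳ _))

∑<-skip-zeros : ∀ k L f → (∀ j → j < k → f j ≡ 0) → ∑< (k + L) f ≡ ∑< L (λ j → f (k + j))
∑<-skip-zeros zero    L f _    = refl
∑<-skip-zeros (suc k) L f f≡0 = trans (cong (_+ ∑< (k + L) (λ j → f (suc j))) (f≡0 0 (s≤s z≤n)))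
  (∑<-skip-zeros k L (λ j → f (suc j)) (λ j j<k → f≡0 (suc j) (s≤s j<k)))

∑<-pad-zeros : ∀ L M f → (∀ j → L ≤ j → f j ≡ 0) → ∑< (L + M) f ≡ ∑< L f
∑<-pad-zeros L zero    f _    = cong (λ n → ∑< n f) (+-identityʳ L)
∑<-pad-zeros L (suc M) f f≡0 = begin
  ∑< (L + suc M) f  ≡⟨ cong (λ n → ∑< n f) (+-suc L M) ⟩
  ∑< (suc (L + M)) f ≡⟨ ∑<-snoc-0 (L + M) f (f≡0 (L + M) (m≤m+n L M)) ⟩
  ∑< (L + M) f      ≡⟨ ∑<-pad-zeros L M f f≡0 ⟩
  ∑< L f            ∎
  where open ≡-Reasoning

-- U m k = Σᵢ C(m - i, i) C(i, k) is the coefficient of yᵏ in the Fibonacci polynomial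
-- Σᵢ C(m - i, i) xⁱ at x = 1 + y.
U : ℕ → ℕ → ℕ
U m k = ∑< (suc m) λ i → binom (m ∸ i) i * binom i k

U-≡0 : ∀ {m k} → m < k + k → U m k ≡ 0
U-≡0 {m} {k} m<2k = ∑<-zero (suc m) term≡0
  where
  term≡0 : ∀ i → i < suc m → binom (m ∸ i) i * binom i k ≡ 0
  term≡0 i _ with i <? k
  ... | yes i<k = trans (cong (binom (m ∸ i) i *_) (binom-≡0 i<k)) (*-zeroʳ (binom (m ∸ i) i))
  ... | no  i≮k = cong (_* binom i k) (binom-≡0 (∸-<-half {m} {i} (<-≤-trans m<2k (+-mono-≤ k≤i k≤i))))
    where
    k≤i : k ≤ i
    k≤i = ≮⇒≥ i≮k

binom-∸-suc-self : ∀ m l → binom (m ∸ suc m) (suc l) ≡ 0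
binom-∸-suc-self m l = cong (λ d → binom d (suc l)) (m≤n⇒m∸n≡0 (n≤1+n m))

∑-binom-shift : ∀ m k → ∑< (suc m) (λ j → binom (m ∸ j) j * shift (binom j) k) ≡ shift (U m) k
∑-binom-shift m zero    = ∑<-zero (suc m) (λ j _ → *-zeroʳ (binom (m ∸ j) j))
∑-binom-shift m (suc k) = refl

∑-binom-suc : ∀ m k → ∑< (2 + m) (λ j → binom (m ∸ j) j * binom (suc j) k) ≡ U m k + shift (U m) k
∑-binom-suc m k = begin
  ∑< (2 + m) (λ j → binom (m ∸ j) j * binom (suc j) k)  ≡⟨ ∑<-cong (2 + m) (λ j _ → split j) ⟩
  ∑< (2 + m) (λ j → g j + h j)                          ≡⟨ ∑<-distrib-+ (2 + m) g h ⟩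
  ∑< (2 + m) g + ∑< (2 + m) h                           ≡⟨ cong₂ _+_ drop-g drop-h ⟩
  U m k + shift (U m) k                                 ∎
  where
  open ≡-Reasoning
  g h : ℕ → ℕ
  g j = binom (m ∸ j) j * binom j k
  h j = binom (m ∸ j) j * shift (binom j) k
  split : ∀ j → binom (m ∸ j) j * binom (suc j) k ≡ g j + h j
  split j = trans (cong (binom (m ∸ j) j *_) (binom-suc j k)) (*-distribˡ-+ (binom (m ∸ j) j) (binom j k) _)
  drop-g : ∑< (2 + m) g ≡ U m k
  drop-g = ∑<-snoc-0 (suc m) g (cong (_* binom (suc m) k) (binom-∸-suc-self m m))
  drop-h : ∑< (2 + m) h ≡ shift (U m) k
  drop-h = trans (∑<-snoc-0 (suc m) h (cong (_* shift (binom (suc m)) k) (binom-∸-suc-self m m)))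
                 (∑-binom-shift m k)

U-pascal : ∀ m k → U (2 + m) k ≡ U (1 + m) k + U m k + shift (U m) k
U-pascal m k = begin
  U (2 + m) k                                        ≡⟨ cong (b₀ +_) (∑<-cong (2 + m) (λ j _ → split j)) ⟩
  b₀ + ∑< (2 + m) (λ j → f j + e j)                  ≡⟨ cong (b₀ +_) (∑<-distrib-+ (2 + m) f e) ⟩
  b₀ + (∑< (2 + m) f + ∑< (2 + m) e)                 ≡⟨ cong (b₀ +_) (cong₂ _+_ drop-f (∑-binom-suc m k)) ⟩
  b₀ + (∑< (1 + m) f + (U m k + shift (U m) k))      ≡⟨ reassoc b₀ (∑< (1 + m) f) (U m k) (shift (U m) k) ⟩
  U (1 + m) k + U m k + shift (U m) k                ∎
  where
  open ≡-Reasoning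
  b₀ : ℕ
  b₀ = 1 * binom 0 k
  f e : ℕ → ℕ
  f j = binom (m ∸ j) (suc j) * binom (suc j) k
  e j = binom (m ∸ j) j * binom (suc j) k
  split : ∀ j → binom (suc m ∸ j) (suc j) * binom (suc j) k ≡ f j + e j
  split j = trans (cong (_* binom (suc j) k) (binom-∸-suc m j j ≤-refl))
                  (*-distribʳ-+ (binom (suc j) k) (binom (m ∸ j) (suc j)) (binom (m ∸ j) j))
  drop-f : ∑< (2 + m) f ≡ ∑< (1 + m) f
  drop-f = ∑<-snoc-0 (suc m) f (cong (_* binom (2 + m) k) (binom-∸-suc-self m (suc m)))
  reassoc : ∀ a b c d → a + (b + (c + d)) ≡ a + b + c + d
  reassoc = solve-∀

-- F s N = [z^N] (1 - z - z²)^(-s)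
F : ℕ → ℕ → ℕ
F zero    zero          = 1
F zero    (suc N)       = 0
F (suc s) zero          = 1
F (suc s) (suc zero)    = F s 1 + 1
F (suc s) (suc (suc N)) = F s (suc (suc N)) + F (suc s) (suc N) + F (suc s) N

F≢0 : ∀ s N → NonZero (F (suc s) N)
F≢0 s zero          = _
F≢0 s (suc zero)    = +-nonZeroʳ (F s 1) 1
F≢0 s (suc (suc N)) = +-nonZeroʳ (F s (2 + N) + F (suc s) (suc N)) (F (suc s) N) {{F≢0 s N}}

diag-shift : ∀ k N → suc k + suc k + N ≡ k + k + suc (suc N)
diag-shift = solve-∀

diag-suc : ∀ k N → suc k + suc k + N ≡ suc (k + k + suc N)
diag-suc k N = trans (diag-shift k N) (+-suc (k + k) (suc N))

U-pascal-diag : ∀ k N → U (suc k + suc k + N) (suc k) ≡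
                U (suc (k + k + N)) (suc k) + U (k + k + N) (suc k) + U (k + k + N) k
U-pascal-diag k N = trans (cong (λ m → U m (suc k)) (trans (diag-suc k N) (cong suc (+-suc (k + k) N))))
                          (U-pascal (k + k + N) (suc k))

U-≡0-diag : ∀ k {m} → m ≤ suc (k + k) → U m (suc k) ≡ 0
U-≡0-diag k {m} m≤ = U-≡0 {m} {suc k} (subst (m <_) (cong suc (sym (+-suc k k))) (s≤s m≤))

U-F : ∀ k N → U (k + k + N) k ≡ F (suc k) N
U-F zero    zero          = refl
U-F zero    (suc zero)    = refl
U-F zero    (suc (suc N)) = trans (U-pascal N 0) (trans (+-identityʳ _) (cong₂ _+_ (U-F 0 (suc N)) (U-F 0 N)))
U-F (suc k) zero          = begin
  U (suc k + suc k + 0) (suc k)                                          ≡⟨ U-pascal-diag k 0 ⟩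
  U (suc (k + k + 0)) (suc k) + U (k + k + 0) (suc k) + U (k + k + 0) k
    ≡⟨ cong₂ (λ a b → a + b + U (k + k + 0) k) (U-≡0-diag k (s≤s 2k+0≤2k)) (U-≡0-diag k (m≤n⇒m≤1+n 2k+0≤2k)) ⟩
  U (k + k + 0) k                                                        ≡⟨ U-F k 0 ⟩
  1                                                                      ∎
  where
  open ≡-Reasoning
  2k+0≤2k : k + k + 0 ≤ k + k
  2k+0≤2k = ≤-reflexive (+-identityʳ (k + k))
U-F (suc k) (suc zero)    = begin
  U (suc k + suc k + 1) (suc k)                                          ≡⟨ U-pascal-diag k 1 ⟩
  U (suc (k + k + 1)) (suc k) + U (k + k + 1) (suc k) + U (k + k + 1) k
    ≡⟨ cong₂ (λ a b → a + b + U (k + k + 1) k)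
             (trans (cong (λ m → U m (suc k)) (sym (diag-suc k 0))) (U-F (suc k) 0))
             (U-≡0-diag k (≤-reflexive (+-comm (k + k) 1))) ⟩
  1 + 0 + U (k + k + 1) k                                                ≡⟨ cong suc (U-F k 1) ⟩
  1 + F (suc k) 1                                                        ≡⟨ +-comm 1 (F (suc k) 1) ⟩
  F (2 + k) 1                                                            ∎
  where open ≡-Reasoning
U-F (suc k) (suc (suc N)) = begin
  U (suc k + suc k + suc (suc N)) (suc k)                                ≡⟨ U-pascal-diag k (suc (suc N)) ⟩
  U (suc (k + k + suc (suc N))) (suc k) + U (k + k + suc (suc N)) (suc k) + U (k + k + suc (suc N)) k
    ≡⟨ cong₂ (λ a b → a + b + U (k + k + suc (suc N)) k)
             (trans (cong (λ m → U m (suc k)) (sym (diag-suc k (suc N)))) (U-F (suc k) (suc N)))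
             (trans (cong (λ m → U m (suc k)) (sym (diag-shift k N))) (U-F (suc k) N)) ⟩
  F (2 + k) (suc N) + F (2 + k) N + U (k + k + suc (suc N)) k            ≡⟨ cong (F (2 + k) (suc N) + F (2 + k) N +_) (U-F k (suc (suc N))) ⟩
  F (2 + k) (suc N) + F (2 + k) N + F (suc k) (suc (suc N))              ≡⟨ rotate (F (2 + k) (suc N)) (F (2 + k) N) (F (suc k) (suc (suc N))) ⟩
  F (2 + k) (suc (suc N))                                                ∎
  where
  open ≡-Reasoning
  rotate : ∀ a b c → a + b + c ≡ c + a + b
  rotate = solve-∀

shift-U-pascal : ∀ m k → shift (U (2 + m)) k ≡ shift (U (1 + m)) k + shift (U m) k + shift (shift (U m)) k
shift-U-pascal m zero    = refl
shift-U-pascal m (suc k) = U-pascal m k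

U-F-at : ∀ k N {m} → m ≡ k + k + N → U m k ≡ F (suc k) N
U-F-at k N refl = U-F k N

shift-U-F-at : ∀ k N {m} → m ≡ k + k + N → shift (U m) k ≡ F k (2 + N)
shift-U-F-at zero    N _    = refl
shift-U-F-at (suc k) N refl = U-F-at k (2 + N) (diag-shift k N)

F-1 : ∀ s → F s 1 ≡ s
F-1 zero    = refl
F-1 (suc s) = trans (cong (_+ 1) (F-1 s)) (+-comm s 1)

-- Coefficient of z^(N+1) in d/dz (1 - z - z²)^(-s) = s (1 + 2z) (1 - z - z²)^(-s-1).
F-derivative : ∀ s N → s * (F (suc s) (suc N) + 2 * F (suc s) N) ≡ (2 + N) * F s (2 + N)
F-derivative zero    N             = sym (*-zeroʳ (2 + N))
F-derivative (suc s) zero          =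
  cancel-≡-summands (F-derivative s 0) (identity (F s 2) (F-1 (suc s)))
  where
  identity : ∀ a {f} → f ≡ suc s →
             suc s * ((f + 1) + 2 * 1) + 2 * a ≡ 2 * (a + f + 1) + s * (f + 2 * 1)
  identity a refl = polynomial s a
    where
    polynomial : ∀ s a → suc s * ((suc s + 1) + 2 * 1) + 2 * a ≡ 2 * (a + suc s + 1) + s * (suc s + 2 * 1)
    polynomial = solve-∀
F-derivative (suc s) (suc zero)    =
  cancel-≡-summands (cong₂ _+_ (F-derivative s 1) (F-derivative s 0)) (identity (F s 2) (F s 3) (F-1 (suc s)))
  where
  identity : ∀ a b {f} → f ≡ suc s →
             suc s * (((a + f + 1) + (f + 1) + 1) + 2 * (f + 1)) + (3 * b + 2 * a)
             ≡ 3 * (b + (a + f + 1) + f) + (s * ((a + f + 1) + 2 * f) + s * (f + 2 * 1))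
  identity a b refl = polynomial s a b
    where
    polynomial : ∀ s a b →
                 suc s * (((a + suc s + 1) + (suc s + 1) + 1) + 2 * (suc s + 1)) + (3 * b + 2 * a)
                 ≡ 3 * (b + (a + suc s + 1) + suc s) + (s * ((a + suc s + 1) + 2 * suc s) + s * (suc s + 2 * 1))
    polynomial = solve-∀
F-derivative (suc s) (suc (suc N)) =
  cancel-≡-summands
    (cong₂ _+_ (cong₂ _+_ (F-derivative (suc s) N) (F-derivative (suc s) (suc N))) (F-derivative s (2 + N)))
    (polynomial s N (F (suc s) (3 + N)) (F (suc s) (2 + N)) (F (2 + s) (suc N)) (F (2 + s) N) (F s (4 + N)))
  where
  polynomial : ∀ s N p q r₁ r₀ w →
               suc s * ((p + (q + r₁ + r₀) + r₁) + 2 * (q + r₁ + r₀))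
                 + ((2 + N) * q + (3 + N) * p + (4 + N) * w)
               ≡ (4 + N) * (w + p + q)
                 + (suc s * (r₁ + 2 * r₀) + suc s * ((q + r₁ + r₀) + 2 * r₁) + s * (p + 2 * q))
  polynomial = solve-∀

F-recurrence : ∀ s N → (2 + N) * F (suc s) (2 + N) ≡ (2 + N + s) * F (suc s) (suc N) + (2 + N + 2 * s) * F (suc s) N
F-recurrence s N =
  cancel-≡-summands (sym (F-derivative s N)) (polynomial s N (F s (2 + N)) (F (suc s) (suc N)) (F (suc s) N))
  where
  polynomial : ∀ s N g a b → (2 + N) * (g + a + b) + s * (a + 2 * b) ≡ (2 + N + s) * a + (2 + N + 2 * s) * b + (2 + N) * g
  polynomial = solve-∀

F-level : ∀ t M → 5 * suc t * F (2 + t) (suc M) + (2 + M + 2 * suc t) * F (suc t) (2 + M) ≡ 2 * (3 + M) * F (suc t) (3 + M)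
F-level t M =
  cancel-≡-summands (cong₂ _+_ (cong (2 *_) (F-derivative (suc t) (suc M))) (sym (F-derivative (suc t) M)))
    (polynomial t M (F (2 + t) (suc M)) (F (2 + t) M) (F (suc t) (2 + M)) (F (suc t) (3 + M)))
  where
  polynomial : ∀ t M f₁ f₀ g₂ g₃ →
               5 * suc t * f₁ + (2 + M + 2 * suc t) * g₂ + (2 * ((3 + M) * g₃) + suc t * (f₁ + 2 * f₀))
               ≡ 2 * (3 + M) * g₃ + (2 * (suc t * ((g₂ + f₁ + f₀) + 2 * f₁)) + (2 + M) * g₂)
  polynomial = solve-∀

-- y / x ≥ p / q.  A record rather than p * x ≤ q * y, so that p, q, x and y are found by unification.
record RatioAtLeast (p q x y : ℕ) : Set where
  constructor ratio≥
  field cross : p * x ≤ q * y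

open RatioAtLeast public

-- K z = α y + β x for consecutive terms x, y, z; a record for the same reason.
record Recurrence (K α β x y z : ℕ) : Set where
  field equation : K * z ≡ α * y + β * x

open Recurrence public

F-recurrence-at : ∀ s N {K α β} → K ≡ 2 + N → α ≡ 2 + N + s → β ≡ 2 + N + 2 * s →
                  Recurrence K α β (F (suc s) N) (F (suc s) (suc N)) (F (suc s) (2 + N))
F-recurrence-at s N refl refl refl = record { equation = F-recurrence s N }

F-level-at : ∀ t M {a b c} → a ≡ 5 * suc t → b ≡ 2 + M + 2 * suc t → c ≡ 2 * (3 + M) →
             a * F (2 + t) (suc M) + b * F (suc t) (2 + M) ≡ c * F (suc t) (3 + M)
F-level-at t M refl refl refl = F-level t M

ratio-weaken : ∀ {p q p′ q′ x y} .{{_ : NonZero p}} → p′ * q ≤ q′ * p → RatioAtLeast p q x y → RatioAtLeast p′ q′ x y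
ratio-weaken {p} {q} {p′} {q′} {x} {y} cond (ratio≥ px≤qy) = ratio≥ (*-cancelˡ-≤ p (begin
  p * (p′ * x)    ≡⟨ exchange p p′ x ⟩
  p′ * (p * x)    ≤⟨ *-monoʳ-≤ p′ px≤qy ⟩
  p′ * (q * y)    ≡⟨ *-assoc p′ q y ⟨
  p′ * q * y      ≤⟨ *-monoˡ-≤ y cond ⟩
  q′ * p * y      ≡⟨ rotate q′ p y ⟩
  p * (q′ * y)    ∎))
  where
  open ≤-Reasoning
  exchange : ∀ a b c → a * (b * c) ≡ b * (a * c)
  exchange = solve-∀
  rotate : ∀ a b c → a * b * c ≡ b * (a * c)
  rotate = solve-∀

module _ {K α β x y z : ℕ} (recurrence : Recurrence K α β x y z) where

  recurrence-lower : ∀ {c d p q} .{{_ : NonZero α}} .{{_ : NonZero d}} →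
                     RatioAtLeast c d y x → p * (K * d) ≤ q * (α * d + β * c) → RatioAtLeast p q y z
  recurrence-lower {c} {d} (ratio≥ cy≤dx) cond =
    ratio-weaken {{+-nonZeroˡ (α * d) (β * c) {{m*n≢0 α d}}}} cond (ratio≥ (begin
    (α * d + β * c) * y       ≡⟨ expand α d β c y ⟩
    α * d * y + β * (c * y)   ≤⟨ +-monoʳ-≤ (α * d * y) (*-monoʳ-≤ β cy≤dx) ⟩
    α * d * y + β * (d * x)   ≡⟨ collect α d y β x ⟩
    d * (α * y + β * x)       ≡⟨ cong (d *_) (equation recurrence) ⟨
    d * (K * z)               ≡⟨ rotate d K z ⟩
    K * d * z                 ∎))
    where
    open ≤-Reasoning
    expand : ∀ α d β c y → (α * d + β * c) * y ≡ α * d * y + β * (c * y)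
    expand = solve-∀
    collect : ∀ α d y β x → α * d * y + β * (d * x) ≡ d * (α * y + β * x)
    collect = solve-∀
    rotate : ∀ d K z → d * (K * z) ≡ K * d * z
    rotate = solve-∀

  recurrence-upper : ∀ {a b p q} .{{_ : NonZero K}} .{{_ : NonZero a}} →
                     RatioAtLeast a b x y → p * (α * a + β * b) ≤ q * (K * a) → RatioAtLeast p q z y
  recurrence-upper {a} {b} (ratio≥ ax≤by) cond =
    ratio-weaken {{m*n≢0 K a}} cond (ratio≥ (begin
    K * a * z                 ≡⟨ rotate K a z ⟩
    a * (K * z)               ≡⟨ cong (a *_) (equation recurrence) ⟩
    a * (α * y + β * x)       ≡⟨ expand a α y β x ⟩
    α * a * y + β * (a * x)   ≤⟨ +-monoʳ-≤ (α * a * y) (*-monoʳ-≤ β ax≤by) ⟩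
    α * a * y + β * (b * y)   ≡⟨ collect α a y β b ⟩
    (α * a + β * b) * y       ∎))
    where
    open ≤-Reasoning
    rotate : ∀ K a z → K * a * z ≡ a * (K * z)
    rotate = solve-∀
    expand : ∀ a α y β x → a * (α * y + β * x) ≡ α * a * y + β * (a * x)
    expand = solve-∀
    collect : ∀ α a y β b → α * a * y + β * (b * y) ≡ (α * a + β * b) * y
    collect = solve-∀

module _ {t w g₀ g₁ f₀ f₁ : ℕ} .{{_ : NonZero t}}
         (level₀ : t * 5 * f₀ + t * 6 * g₀ ≡ w * 2 * g₁)
         (level₁ : t * 5 * f₁ ≡ w * g₁ + t * 12 * g₀) where

  private instance
    5t≢0 : NonZero (t * 5)
    5t≢0 = m*n≢0 t 5

  level-lower : ∀ {c d p q} .{{_ : NonZero d}} →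
                RatioAtLeast c d g₁ g₀ → p * w * d * 2 ≤ q * w * d + (q * 12 + p * 6) * t * c → RatioAtLeast p q f₀ f₁
  level-lower {c} {d} {p} {q} (ratio≥ cg₁≤dg₀) cond = ratio≥ (
    *-cancelˡ-≤ (t * 5) (+-cancelʳ-≤ (t * p * 6 * g₀) (t * 5 * (p * f₀)) (t * 5 * (q * f₁)) (begin
      t * 5 * (p * f₀) + t * p * 6 * g₀            ≡⟨ factor p t f₀ g₀ ⟩
      p * (t * 5 * f₀ + t * 6 * g₀)                ≡⟨ cong (p *_) level₀ ⟩
      p * (w * 2 * g₁)                             ≡⟨ reorder p w g₁ ⟩
      p * w * g₁ * 2                               ≤⟨ g-bound ⟩
      q * w * g₁ + M * g₀                          ≡⟨ regroup q w g₁ p t g₀ ⟩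
      q * (w * g₁ + t * 12 * g₀) + t * p * 6 * g₀  ≡⟨ cong (λ e → q * e + t * p * 6 * g₀) level₁ ⟨
      q * (t * 5 * f₁) + t * p * 6 * g₀            ≡⟨ cong (_+ t * p * 6 * g₀) (exchange q (t * 5) f₁) ⟩
      t * 5 * (q * f₁) + t * p * 6 * g₀            ∎)))
    where
    open ≤-Reasoning
    M : ℕ
    M = (q * 12 + p * 6) * t
    g-bound : p * w * g₁ * 2 ≤ q * w * g₁ + M * g₀
    g-bound = *-cancelˡ-≤ d (begin
      d * (p * w * g₁ * 2)              ≡⟨ pull d p w g₁ ⟩
      p * w * d * 2 * g₁                ≤⟨ *-monoˡ-≤ g₁ cond ⟩
      (q * w * d + M * c) * g₁          ≡⟨ spread q w d M c g₁ ⟩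
      d * (q * w * g₁) + M * (c * g₁)   ≤⟨ +-monoʳ-≤ (d * (q * w * g₁)) (*-monoʳ-≤ M cg₁≤dg₀) ⟩
      d * (q * w * g₁) + M * (d * g₀)   ≡⟨ collect d q w g₁ M g₀ ⟩
      d * (q * w * g₁ + M * g₀)         ∎)
      where
      pull : ∀ d p w g → d * (p * w * g * 2) ≡ p * w * d * 2 * g
      pull = solve-∀
      spread : ∀ q w d M c g → (q * w * d + M * c) * g ≡ d * (q * w * g) + M * (c * g)
      spread = solve-∀
      collect : ∀ d q w g M g₀ → d * (q * w * g) + M * (d * g₀) ≡ d * (q * w * g + M * g₀)
      collect = solve-∀
    factor : ∀ p t f g → t * 5 * (p * f) + t * p * 6 * g ≡ p * (t * 5 * f + t * 6 * g)
    factor = solve-∀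
    reorder : ∀ p w g → p * (w * 2 * g) ≡ p * w * g * 2
    reorder = solve-∀
    regroup : ∀ q w g₁ p t g₀ → q * w * g₁ + (q * 12 + p * 6) * t * g₀ ≡ q * (w * g₁ + t * 12 * g₀) + t * p * 6 * g₀
    regroup = solve-∀
    exchange : ∀ a b c → a * (b * c) ≡ b * (a * c)
    exchange = solve-∀

  level-upper : ∀ {a b p q} .{{_ : NonZero a}} →
                RatioAtLeast a b g₀ g₁ → (t * p * 12 + t * q * 6) * b + w * p * a ≤ w * q * a * 2 → RatioAtLeast p q f₁ f₀
  level-upper {a} {b} {p} {q} (ratio≥ ag₀≤bg₁) cond = ratio≥ (
    *-cancelˡ-≤ (t * 5) (+-cancelʳ-≤ (t * q * 6 * g₀) (t * 5 * (p * f₁)) (t * 5 * (q * f₀)) (begin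
      t * 5 * (p * f₁) + t * q * 6 * g₀            ≡⟨ cong (_+ t * q * 6 * g₀) (exchange (t * 5) p f₁) ⟩
      p * (t * 5 * f₁) + t * q * 6 * g₀            ≡⟨ cong (λ e → p * e + t * q * 6 * g₀) level₁ ⟩
      p * (w * g₁ + t * 12 * g₀) + t * q * 6 * g₀  ≡⟨ regroup p w g₁ t g₀ q ⟩
      w * p * g₁ + N * g₀                          ≤⟨ g-bound ⟩
      w * q * g₁ * 2                               ≡⟨ reorder w q g₁ ⟩
      q * (w * 2 * g₁)                             ≡⟨ cong (q *_) level₀ ⟨
      q * (t * 5 * f₀ + t * 6 * g₀)                ≡⟨ expand q t f₀ g₀ ⟩
      t * 5 * (q * f₀) + t * q * 6 * g₀            ∎)))
    where
    open ≤-Reasoning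
    N : ℕ
    N = t * p * 12 + t * q * 6
    g-bound : w * p * g₁ + N * g₀ ≤ w * q * g₁ * 2
    g-bound = *-cancelˡ-≤ a (begin
      a * (w * p * g₁ + N * g₀)         ≡⟨ spread a w p g₁ N g₀ ⟩
      w * p * a * g₁ + N * (a * g₀)     ≤⟨ +-monoʳ-≤ (w * p * a * g₁) (*-monoʳ-≤ N ag₀≤bg₁) ⟩
      w * p * a * g₁ + N * (b * g₁)     ≡⟨ collect w p a g₁ N b ⟩
      (N * b + w * p * a) * g₁          ≤⟨ *-monoˡ-≤ g₁ cond ⟩
      w * q * a * 2 * g₁                ≡⟨ pull w q a g₁ ⟩
      a * (w * q * g₁ * 2)              ∎)
      where
      spread : ∀ a w p g N g₀ → a * (w * p * g + N * g₀) ≡ w * p * a * g + N * (a * g₀)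
      spread = solve-∀
      collect : ∀ w p a g N b → w * p * a * g + N * (b * g) ≡ (N * b + w * p * a) * g
      collect = solve-∀
      pull : ∀ w q a g → w * q * a * 2 * g ≡ a * (w * q * g * 2)
      pull = solve-∀
    exchange : ∀ a b c → a * (b * c) ≡ b * (a * c)
    exchange = solve-∀
    regroup : ∀ p w g₁ t g₀ q → p * (w * g₁ + t * 12 * g₀) + t * q * 6 * g₀ ≡ w * p * g₁ + (t * p * 12 + t * q * 6) * g₀
    regroup = solve-∀
    reorder : ∀ w q g → w * q * g * 2 ≡ q * (w * 2 * g)
    reorder = solve-∀
    expand : ∀ q t f g → q * (t * 5 * f + t * 6 * g) ≡ t * 5 * (q * f) + t * q * 6 * g
    expand = solve-∀

-- The ratio at the mode

CentralRatioBounds : ℕ → Set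
CentralRatioBounds u = RatioAtLeast (u * 40 + 31) (u * 20 + 20) (F (suc u) (3 + u * 4)) (F (suc u) (4 + u * 4))
                     × RatioAtLeast 1 2 (F (suc u) (4 + u * 4)) (F (suc u) (3 + u * 4))

-- g and f collect the F-values that make up lucas (6u + 4 + i) at k = u and k = u + 1.  Coefficients are
-- written u * c + a, never a + u * c: the latter unfolds to a tower of suc, which defeats unification and
-- makes the ring solver slow.
module Mode (u : ℕ) where

  g f : ℕ → ℕ
  g j = F (suc u) (j + u * 4)
  f j = F (2 + u) (j + u * 4)

  g≢0 : ∀ j → NonZero (g j)
  g≢0 j = F≢0 u (j + u * 4)

  D : ℕ
  D = u * 200 + 400

  instance
    u*c+a≢0 : ∀ {c a} .{{_ : NonZero a}} → NonZero (u * c + a)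
    u*c+a≢0 {c} {a} = +-nonZeroʳ (u * c) a
    u+1≢0 : NonZero (u + 1)
    u+1≢0 = +-nonZeroʳ u 1

  Between : ℕ → ℕ → ℕ → ℕ → Set
  Between a b x y = RatioAtLeast (u * 400 + a) D x y × RatioAtLeast D (u * 400 + b) y x

  g-recurrence : ∀ j → Recurrence (u * 4 + (2 + j)) (u * 5 + (2 + j)) (u * 6 + (2 + j)) (g j) (g (1 + j)) (g (2 + j))
  g-recurrence j = F-recurrence-at u (j + u * 4) (coefficient₀ u j) (coefficient₁ u j) (coefficient₂ u j)
    where
    coefficient₀ : ∀ u j → u * 4 + (2 + j) ≡ 2 + (j + u * 4)
    coefficient₀ = solve-∀
    coefficient₁ : ∀ u j → u * 5 + (2 + j) ≡ 2 + (j + u * 4) + u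
    coefficient₁ = solve-∀
    coefficient₂ : ∀ u j → u * 6 + (2 + j) ≡ 2 + (j + u * 4) + 2 * u
    coefficient₂ = solve-∀

  f-recurrence : ∀ j → Recurrence (u * 4 + (2 + j)) (u * 5 + (3 + j)) (u * 6 + (4 + j)) (f j) (f (1 + j)) (f (2 + j))
  f-recurrence j = F-recurrence-at (suc u) (j + u * 4) (coefficient₀ u j) (coefficient₁ u j) (coefficient₂ u j)
    where
    coefficient₀ : ∀ u j → u * 4 + (2 + j) ≡ 2 + (j + u * 4)
    coefficient₀ = solve-∀
    coefficient₁ : ∀ u j → u * 5 + (3 + j) ≡ 2 + (j + u * 4) + suc u
    coefficient₁ = solve-∀
    coefficient₂ : ∀ u j → u * 6 + (4 + j) ≡ 2 + (j + u * 4) + 2 * suc u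
    coefficient₂ = solve-∀

  level : ∀ j → (u + 1) * 5 * f (1 + j) + (u * 6 + (4 + j)) * g (2 + j) ≡ (u * 4 + (3 + j)) * 2 * g (3 + j)
  level j = F-level-at u (j + u * 4) (coefficient₀ u) (coefficient₁ u j) (coefficient₂ u j)
    where
    coefficient₀ : ∀ u → (u + 1) * 5 ≡ 5 * suc u
    coefficient₀ = solve-∀
    coefficient₁ : ∀ u j → u * 6 + (4 + j) ≡ 2 + (j + u * 4) + 2 * suc u
    coefficient₁ = solve-∀
    coefficient₂ : ∀ u j → (u * 4 + (3 + j)) * 2 ≡ 2 * (3 + (j + u * 4))
    coefficient₂ = solve-∀

  level₀ : (u + 1) * 5 * f 3 + (u + 1) * 6 * g 4 ≡ (u * 4 + 5) * 2 * g 5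
  level₀ = trans (cong (λ β → (u + 1) * 5 * f 3 + β * g 4) (coefficient u)) (level 2)
    where
    coefficient : ∀ u → (u + 1) * 6 ≡ u * 6 + 6
    coefficient = solve-∀

  level₁ : (u + 1) * 5 * f 4 ≡ (u * 4 + 5) * g 5 + (u + 1) * 12 * g 4
  level₁ = cancel-≡-summands (cong₂ _+_ (level 3) (cong (_* 2) (equation (g-recurrence 4))))
             (polynomial u (f 4) (g 4) (g 5) (g 6))
    where
    polynomial : ∀ u f₄ g₄ g₅ g₆ →
                 (u + 1) * 5 * f₄ + ((u * 4 + 6) * 2 * g₆ + ((u * 5 + 6) * g₅ + (u * 6 + 6) * g₄) * 2)
                 ≡ (u * 4 + 5) * g₅ + (u + 1) * 12 * g₄ + ((u + 1) * 5 * f₄ + (u * 6 + 7) * g₅ + (u * 4 + 6) * g₆ * 2)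
    polynomial = solve-∀

  g-step : CentralRatioBounds u → Between 600 709 (g 4) (g 5)
  g-step (lower , upper) =
      recurrence-lower (g-recurrence 3) upper (≤-by-slack (lower-certificate u))
    , recurrence-upper (g-recurrence 3) lower (≤-by-slack (upper-certificate u))
    where
    lower-certificate : ∀ u → (u * 200 + 400) * ((u * 5 + 5) * 2 + (u * 6 + 5) * 1)
                              ≡ (u * 400 + 600) * ((u * 4 + 5) * 2) + u * 600
    lower-certificate = solve-∀
    upper-certificate : ∀ u → (u * 400 + 709) * ((u * 4 + 5) * (u * 40 + 31))
                              ≡ (u * 200 + 400) * ((u * 5 + 5) * (u * 40 + 31) + (u * 6 + 5) * (u * 20 + 20))
                                + (u * u * 40 + u * 10716 + 7895)
    upper-certificate = solve-∀

  level-step : Between 600 709 (g 4) (g 5) → Between 711 920 (f 3) (f 4)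
  level-step (lower , upper) =
      level-lower {t = u + 1} {w = u * 4 + 5} level₀ level₁ upper (≤-by-slack (lower-certificate u))
    , level-upper {t = u + 1} {w = u * 4 + 5} level₀ level₁ lower (≤-by-slack (upper-certificate u))
    where
    lower-certificate : ∀ u → (u * 200 + 400) * (u * 4 + 5) * (u * 400 + 709)
                                + ((u * 200 + 400) * 12 + (u * 400 + 711) * 6) * (u + 1) * (u * 200 + 400)
                              ≡ (u * 400 + 711) * (u * 4 + 5) * (u * 400 + 709) * 2
                                + (u * u * 156400 + u * 290208 + 3410)
    lower-certificate = solve-∀
    upper-certificate : ∀ u → (u * 4 + 5) * (u * 400 + 920) * (u * 400 + 600) * 2
                              ≡ ((u + 1) * (u * 200 + 400) * 12 + (u + 1) * (u * 400 + 920) * 6) * (u * 200 + 400)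
                                + (u * 4 + 5) * (u * 200 + 400) * (u * 400 + 600)
                                + (u * 24000 + 192000)
    upper-certificate = solve-∀

  f-step : ∀ j {a b a′ b′} .{{_ : NonZero a}} .{{_ : NonZero b}} →
           (u * 400 + a′) * ((u * 4 + (2 + j)) * (u * 400 + b)) ≤ D * ((u * 5 + (3 + j)) * (u * 400 + b) + (u * 6 + (4 + j)) * D) →
           D * ((u * 5 + (3 + j)) * (u * 400 + a) + (u * 6 + (4 + j)) * D) ≤ (u * 400 + b′) * ((u * 4 + (2 + j)) * (u * 400 + a)) →
           Between a b (f j) (f (1 + j)) → Between a′ b′ (f (1 + j)) (f (2 + j))
  f-step j lower-condition upper-condition (lower , upper) =
      recurrence-lower (f-recurrence j) upper lower-condition
    , recurrence-upper (f-recurrence j) lower upper-condition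

  f-end : Between 715 730 (f 7) (f 8) → CentralRatioBounds (suc u)
  f-end (lower , upper) =
      subst₂ (λ p q → RatioAtLeast p q (f 7) (f 8)) (coefficient₁ u) (coefficient₂ u)
             (ratio-weaken (≤-by-slack (lower-certificate u)) lower)
    , ratio-weaken (≤-by-slack (upper-certificate u)) upper
    where
    coefficient₁ : ∀ u → u * 40 + 71 ≡ suc u * 40 + 31
    coefficient₁ = solve-∀
    coefficient₂ : ∀ u → u * 20 + 40 ≡ suc u * 20 + 20
    coefficient₂ = solve-∀
    lower-certificate : ∀ u → (u * 20 + 40) * (u * 400 + 715) ≡ (u * 40 + 71) * (u * 200 + 400) + (u * 100 + 200)
    lower-certificate = solve-∀
    upper-certificate : ∀ u → 2 * (u * 200 + 400) ≡ 1 * (u * 400 + 730) + 70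
    upper-certificate = solve-∀

  -- The interval endpoints were found numerically; each certificate gives the slack of a polynomial
  -- inequality in u as a polynomial with nonnegative coefficients.
  central-step : CentralRatioBounds u → CentralRatioBounds (suc u)
  central-step bounds =
    f-end (f-step 6 (≤-by-slack (lower₆ u)) (≤-by-slack (upper₆ u))
          (f-step 5 (≤-by-slack (lower₅ u)) (≤-by-slack (upper₅ u))
          (f-step 4 (≤-by-slack (lower₄ u)) (≤-by-slack (upper₄ u))
          (f-step 3 (≤-by-slack (lower₃ u)) (≤-by-slack (upper₃ u))
          (level-step (g-step bounds))))))
    where
    lower₃ : ∀ u → (u * 200 + 400) * ((u * 5 + 6) * (u * 400 + 920) + (u * 6 + 7) * (u * 200 + 400))
                   ≡ (u * 400 + 723) * ((u * 4 + 5) * (u * 400 + 920)) + (u * u * 11200 + u * 37360 + 2200)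
    lower₃ = solve-∀
    upper₃ : ∀ u → (u * 400 + 809) * ((u * 4 + 5) * (u * 400 + 711))
                   ≡ (u * 200 + 400) * ((u * 5 + 6) * (u * 400 + 711) + (u * 6 + 7) * (u * 200 + 400)) + (u * u * 1000 + u * 25596 + 49595)
    upper₃ = solve-∀
    lower₄ : ∀ u → (u * 200 + 400) * ((u * 5 + 7) * (u * 400 + 809) + (u * 6 + 8) * (u * 200 + 400))
                   ≡ (u * 400 + 730) * ((u * 4 + 6) * (u * 400 + 809)) + (u * u * 26600 + u * 54720 + 1780)
    lower₄ = solve-∀
    upper₄ : ∀ u → (u * 400 + 779) * ((u * 4 + 6) * (u * 400 + 723))
                   ≡ (u * 200 + 400) * ((u * 5 + 7) * (u * 400 + 723) + (u * 6 + 8) * (u * 200 + 400)) + (u * u * 200 + u * 39468 + 74902)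
    upper₄ = solve-∀
    lower₅ : ∀ u → (u * 200 + 400) * ((u * 5 + 8) * (u * 400 + 779) + (u * 6 + 9) * (u * 200 + 400))
                   ≡ (u * 400 + 721) * ((u * 4 + 7) * (u * 400 + 779)) + (u * u * 19000 + u * 37764 + 1187)
    lower₅ = solve-∀
    upper₅ : ∀ u → (u * 400 + 752) * ((u * 4 + 7) * (u * 400 + 730))
                   ≡ (u * 200 + 400) * ((u * 5 + 8) * (u * 400 + 730) + (u * 6 + 9) * (u * 200 + 400)) + (u * u * 1200 + u * 37440 + 66720)
    upper₅ = solve-∀
    lower₆ : ∀ u → (u * 200 + 400) * ((u * 5 + 9) * (u * 400 + 752) + (u * 6 + 10) * (u * 200 + 400))
                   ≡ (u * 400 + 715) * ((u * 4 + 8) * (u * 400 + 752)) + (u * u * 4800 + u * 12480 + 5760)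
    lower₆ = solve-∀
    upper₆ : ∀ u → (u * 400 + 730) * ((u * 4 + 8) * (u * 400 + 721))
                   ≡ (u * 200 + 400) * ((u * 5 + 9) * (u * 400 + 721) + (u * 6 + 10) * (u * 200 + 400)) + (u * u * 600 + u * 8720 + 15040)
    upper₆ = solve-∀

central-ratio-bounds : ∀ u → CentralRatioBounds u
central-ratio-bounds zero    = ratio≥ (m≤m+n 93 7) , ratio≥ (m≤m+n 5 1)
central-ratio-bounds (suc u) = Mode.central-step u (central-ratio-bounds u)

-- Monotonicity of the Lucas coefficients

-- lucas n k is the coefficient of yᵏ in Lₙ(1 + y); for n ≥ 2, Lₙ(x) = Σᵢ C(n - i, i) xⁱ + x Σᵢ C(n - 2 - i, i) xⁱ.
lucas : ℕ → ℕ → ℕ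
lucas n k = U n k + U (n ∸ 2) k + shift (U (n ∸ 2)) k

lucas-pascal : ∀ n k → 2 ≤ n → lucas (2 + n) k ≡ lucas (1 + n) k + lucas n k + shift (lucas n) k
lucas-pascal (suc (suc m)) k _ = begin
  U (4 + m) k + U (2 + m) k + shift (U (2 + m)) k
    ≡⟨ cong₂ (λ a b → a + b + shift (U (2 + m)) k) (U-pascal (2 + m) k) (U-pascal m k) ⟩
  (U (3 + m) k + U (2 + m) k + shift (U (2 + m)) k) + (U (1 + m) k + U m k + shift (U m) k) + shift (U (2 + m)) k
    ≡⟨ cong ((U (3 + m) k + U (2 + m) k + shift (U (2 + m)) k) + (U (1 + m) k + U m k + shift (U m) k) +_) (shift-U-pascal m k) ⟩
  (U (3 + m) k + U (2 + m) k + shift (U (2 + m)) k) + (U (1 + m) k + U m k + shift (U m) k)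
    + (shift (U (1 + m)) k + shift (U m) k + shift (shift (U m)) k)
    ≡⟨ regroup (U (3 + m) k) (U (2 + m) k) (shift (U (2 + m)) k) (U (1 + m) k) (U m k) (shift (U m) k)
               (shift (U (1 + m)) k) (shift (shift (U m)) k) ⟩
  (U (3 + m) k + U (1 + m) k + shift (U (1 + m)) k) + (U (2 + m) k + U m k + shift (U m) k)
    + (shift (U (2 + m)) k + shift (U m) k + shift (shift (U m)) k)
    ≡⟨ cong (lucas (3 + m) k + lucas (2 + m) k +_) (shift-lucas k) ⟨
  lucas (3 + m) k + lucas (2 + m) k + shift (lucas (2 + m)) k
    ∎
  where
  open ≡-Reasoning
  regroup : ∀ a b c d e f g h → (a + b + c) + (d + e + f) + (g + f + h) ≡ (a + d + g) + (b + e + f) + (c + f + h)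
  regroup = solve-∀
  shift-lucas : ∀ k → shift (lucas (2 + m)) k ≡ shift (U (2 + m)) k + shift (U m) k + shift (shift (U m)) k
  shift-lucas zero    = refl
  shift-lucas (suc k) = refl
lucas-pascal (suc zero) _ (s≤s ())

mode-index : ∀ u j → j + u * 6 ≡ u + u + (j + u * 4)
mode-index = solve-∀

mode-index-suc : ∀ u j → 2 + j + u * 6 ≡ suc u + suc u + (j + u * 4)
mode-index-suc = solve-∀

module _ (u : ℕ) where
  open Mode u

  lucas-at-mode : ∀ i → lucas (4 + i + u * 6) u ≡ g (4 + i) + g (2 + i) + F u (4 + i + u * 4)
  lucas-at-mode i = +-cong₃ (U-F-at u (4 + i + u * 4) (mode-index u (4 + i)))
                            (U-F-at u (2 + i + u * 4) (mode-index u (2 + i)))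
                            (shift-U-F-at u (2 + i + u * 4) (mode-index u (2 + i)))

  lucas-after-mode : ∀ i → lucas (4 + i + u * 6) (suc u) ≡ f (2 + i) + f i + g (2 + i)
  lucas-after-mode i = +-cong₃ (U-F-at (suc u) (2 + i + u * 4) (mode-index-suc u (2 + i)))
                               (U-F-at (suc u) (i + u * 4) (mode-index-suc u i))
                               (U-F-at u (2 + i + u * 4) (mode-index u (2 + i)))

lucas-<-at-4+6u : ∀ u → lucas (4 + u * 6) u < lucas (4 + u * 6) (suc u)
lucas-<-at-4+6u u = subst₂ _<_ (sym (lucas-at-mode u 0)) (sym (lucas-after-mode u 0)) (<-from-balance (u + 1) balance gap)
  where
  open Mode u
  h : ℕ
  h = F u (4 + u * 4)
  balance : (u + 1) * (g 4 + g 2 + h) + (u + 1) * 2 * g 4 ≡ (u + 1) * (f 2 + f 0 + g 2) + (u * 4 + 3) * g 3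
  balance = cancel-≡-summands (cong₂ _+_ (sym (F-derivative (suc u) (u * 4))) (equation (g-recurrence 2)))
                              (polynomial u h (g 3) (g 2) (f 1) (f 0))
    where
    polynomial : ∀ u h g₃ g₂ f₁ f₀ →
                 (u + 1) * ((h + g₃ + g₂) + g₂ + h) + (u + 1) * 2 * (h + g₃ + g₂)
                   + (suc u * (f₁ + 2 * f₀) + ((u * 5 + 4) * g₃ + (u * 6 + 4) * g₂))
                 ≡ (u + 1) * ((g₂ + f₁ + f₀) + f₀ + g₂) + (u * 4 + 3) * g₃
                   + ((2 + u * 4) * g₂ + (u * 4 + 4) * (h + g₃ + g₂))
    polynomial = solve-∀
  gap : (u * 4 + 3) * g 3 < (u + 1) * 2 * g 4
  gap = *-cancelˡ-< 10 ((u * 4 + 3) * g 3) ((u + 1) * 2 * g 4) (begin-strict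
    10 * ((u * 4 + 3) * g 3)  ≡⟨ scale₁ u (g 3) ⟩
    (u * 40 + 30) * g 3       <⟨ *-monoˡ-< (g 3) {{g≢0 3}} (+-monoʳ-< (u * 40) (n<1+n 30)) ⟩
    (u * 40 + 31) * g 3       ≤⟨ cross (proj₁ (central-ratio-bounds u)) ⟩
    (u * 20 + 20) * g 4       ≡⟨ scale₂ u (g 4) ⟩
    10 * ((u + 1) * 2 * g 4)  ∎)
    where
    open ≤-Reasoning
    scale₁ : ∀ u g → 10 * ((u * 4 + 3) * g) ≡ (u * 40 + 30) * g
    scale₁ = solve-∀
    scale₂ : ∀ u g → (u * 20 + 20) * g ≡ 10 * ((u + 1) * 2 * g)
    scale₂ = solve-∀

lucas-<-at-5+6u : ∀ u → lucas (5 + u * 6) u < lucas (5 + u * 6) (suc u)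
lucas-<-at-5+6u u = subst₂ _<_ (sym (lucas-at-mode u 1)) (sym (lucas-after-mode u 1)) (<-from-balance (u + 1) balance gap)
  where
  open Mode u
  h : ℕ
  h = F u (5 + u * 4)
  balance : (u + 1) * (g 5 + g 3 + h) + (u * 2 + 3) * g 5 ≡ (u + 1) * (f 3 + f 1 + g 3) + (u * 4 + 4) * g 4
  balance = cancel-≡-summands (cong₂ _+_ (sym (F-derivative (suc u) (1 + u * 4))) (equation (g-recurrence 3)))
                              (polynomial u h (g 4) (g 3) (f 2) (f 1))
    where
    polynomial : ∀ u h g₄ g₃ f₂ f₁ →
                 (u + 1) * ((h + g₄ + g₃) + g₃ + h) + (u * 2 + 3) * (h + g₄ + g₃)
                   + (suc u * (f₂ + 2 * f₁) + ((u * 5 + 5) * g₄ + (u * 6 + 5) * g₃))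
                 ≡ (u + 1) * ((g₃ + f₂ + f₁) + f₁ + g₃) + (u * 4 + 4) * g₄
                   + ((3 + u * 4) * g₃ + (u * 4 + 5) * (h + g₄ + g₃))
    polynomial = solve-∀
  g₄<g₃ : (u + 1) * g 4 < (u * 2 + 3) * g 3
  g₄<g₃ = begin-strict
    (u + 1) * g 4        ≡⟨ cong ((u + 1) *_) (*-identityˡ (g 4)) ⟨
    (u + 1) * (1 * g 4)  ≤⟨ *-monoʳ-≤ (u + 1) (cross (proj₂ (central-ratio-bounds u))) ⟩
    (u + 1) * (2 * g 3)  ≡⟨ scale u (g 3) ⟩
    (u * 2 + 2) * g 3    <⟨ *-monoˡ-< (g 3) {{g≢0 3}} (+-monoʳ-< (u * 2) (n<1+n 2)) ⟩
    (u * 2 + 3) * g 3    ∎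
    where
    open ≤-Reasoning
    scale : ∀ u g → (u + 1) * (2 * g) ≡ (u * 2 + 2) * g
    scale = solve-∀
  gap : (u * 4 + 4) * g 4 < (u * 2 + 3) * g 5
  gap = *-cancelˡ-< (u * 4 + 5) ((u * 4 + 4) * g 4) ((u * 2 + 3) * g 5) (begin-strict
    (u * 4 + 5) * ((u * 4 + 4) * g 4)                                   ≡⟨ split u (g 4) ⟩
    (u * 2 + 3) * (u * 5 + 5) * g 4 + (u * 6 + 5) * ((u + 1) * g 4)
      <⟨ +-monoʳ-< ((u * 2 + 3) * (u * 5 + 5) * g 4) (*-monoʳ-< (u * 6 + 5) g₄<g₃) ⟩
    (u * 2 + 3) * (u * 5 + 5) * g 4 + (u * 6 + 5) * ((u * 2 + 3) * g 3) ≡⟨ collect u (g 4) (g 3) ⟩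
    (u * 2 + 3) * ((u * 5 + 5) * g 4 + (u * 6 + 5) * g 3)               ≡⟨ cong ((u * 2 + 3) *_) (equation (g-recurrence 3)) ⟨
    (u * 2 + 3) * ((u * 4 + 5) * g 5)                                   ≡⟨ exchange (u * 2 + 3) (u * 4 + 5) (g 5) ⟩
    (u * 4 + 5) * ((u * 2 + 3) * g 5)                                   ∎)
    where
    open ≤-Reasoning
    split : ∀ u g → (u * 4 + 5) * ((u * 4 + 4) * g) ≡ (u * 2 + 3) * (u * 5 + 5) * g + (u * 6 + 5) * ((u + 1) * g)
    split = solve-∀
    collect : ∀ u g₄ g₃ → (u * 2 + 3) * (u * 5 + 5) * g₄ + (u * 6 + 5) * ((u * 2 + 3) * g₃)
                         ≡ (u * 2 + 3) * ((u * 5 + 5) * g₄ + (u * 6 + 5) * g₃)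
    collect = solve-∀
    exchange : ∀ a b c → a * (b * c) ≡ b * (a * c)
    exchange = solve-∀

Rising : ℕ → Set
Rising n = ∀ k → 4 + k * 6 ≤ n → lucas n k < lucas n (suc k)

rising-step : ∀ n → Rising n → Rising (1 + n) → Rising (2 + n)
rising-step n rising₀ rising₁ k 4+6k≤2+n with m≤n⇒m<n∨m≡n 4+6k≤2+n
... | inj₂ eq = subst (λ m → lucas m k < lucas m (suc k)) eq (lucas-<-at-4+6u k)
... | inj₁ 5+6k≤2+n with m≤n⇒m<n∨m≡n 5+6k≤2+n
...   | inj₂ eq = subst (λ m → lucas m k < lucas m (suc k)) eq (lucas-<-at-5+6u k)
...   | inj₁ 6+6k≤2+n =
  subst₂ _<_ (sym (lucas-pascal n k 2≤n)) (sym (lucas-pascal n (suc k) 2≤n))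
    (+-mono-<-≤ (+-mono-< (rising₁ k (m≤n⇒m≤1+n 4+6k≤n)) (rising₀ k 4+6k≤n)) (shift-≤ k 4+6k≤n))
  where
  4+6k≤n : 4 + k * 6 ≤ n
  4+6k≤n = ≤-pred (≤-pred 6+6k≤2+n)
  2≤n : 2 ≤ n
  2≤n = ≤-trans (s≤s (s≤s z≤n)) 4+6k≤n
  shift-≤ : ∀ k → 4 + k * 6 ≤ n → shift (lucas n) k ≤ lucas n k
  shift-≤ zero    _        = z≤n
  shift-≤ (suc k) 10+6k≤n = <⇒≤ (rising₀ k (≤-trans (+-monoʳ-≤ 4 (m≤n+m (k * 6) 6)) 10+6k≤n))

rising : ∀ n → Rising n × Rising (1 + n)
rising zero    = (λ _ ()) , (λ { _ (s≤s ()) })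
rising (suc n) = proj₂ (rising n) , rising-step n (proj₁ (rising n)) (proj₂ (rising n))

lucas-< : ∀ n k → 4 + k * 6 ≤ n → lucas n k < lucas n (suc k)
lucas-< n = proj₁ (rising n)

-- From JL to lucas

fromℕ : ℕ → ℚ
fromℕ m = mkℚ (ℤ.+ m) 0 (coprime-sym (1-coprimeTo m))

+m/1≡fromℕ : ∀ m → ℤ.+ m ℚ./ 1 ≡ fromℕ m
+m/1≡fromℕ m = ℚ.↥p/↧p≡p (fromℕ m)

fromℕ-+ : ∀ a b → fromℕ a ℚ.+ fromℕ b ≡ fromℕ (a + b)
fromℕ-+ a b = trans (ℚ./-cong {p₂ = ℤ.+ (a + b)} {q₂ = 1} numerator refl) (+m/1≡fromℕ (a + b))
  where
  numerator : ℤ.+ a ℤ.* ℤ.+ 1 ℤ.+ ℤ.+ b ℤ.* ℤ.+ 1 ≡ ℤ.+ (a + b)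
  numerator = trans (cong₂ ℤ._+_ (ℤ.*-identityʳ (ℤ.+ a)) (ℤ.*-identityʳ (ℤ.+ b))) (sym (ℤ.pos-+ a b))

fromℕ-< : ∀ {a b} → a < b → fromℕ a <ℚ fromℕ b
fromℕ-< {a} {b} a<b = *<* (subst₂ ℤ._<_ (sym (ℤ.*-identityʳ (ℤ.+ a))) (sym (ℤ.*-identityʳ (ℤ.+ b))) (ℤ.+<+ a<b))

+[m*n]/n≡fromℕ : ∀ m d → ℤ.+ (m * suc d) ℚ./ suc d ≡ fromℕ m
+[m*n]/n≡fromℕ m d = ℚ.≃⇒≡ (*≡* (ℤ.*-cancelʳ-≡ _ _ (ℤ.+ g) (begin
    ↥ q ℤ.* ℤ.+ 1 ℤ.* ℤ.+ g     ≡⟨ cong (ℤ._* ℤ.+ g) (ℤ.*-identityʳ (↥ q)) ⟩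
    ↥ q ℤ.* ℤ.+ g               ≡⟨ ℚ.↥-/ (ℤ.+ (m * suc d)) (suc d) ⟩
    ℤ.+ (m * suc d)             ≡⟨ ℤ.pos-* m (suc d) ⟩
    ℤ.+ m ℤ.* ℤ.+ suc d         ≡⟨ cong (ℤ.+ m ℤ.*_) (ℚ.↧-/ (ℤ.+ (m * suc d)) (suc d)) ⟨
    ℤ.+ m ℤ.* (↧ q ℤ.* ℤ.+ g)   ≡⟨ ℤ.*-assoc (ℤ.+ m) (↧ q) (ℤ.+ g) ⟨
    ℤ.+ m ℤ.* ↧ q ℤ.* ℤ.+ g     ∎)))
  where
  open ≡-Reasoning
  q : ℚ
  q = ℤ.+ (m * suc d) ℚ./ suc d
  g : ℕ
  g = gcd (m * suc d) (suc d)
  instance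
    g≢0 : NonZero g
    g≢0 = ≢-nonZero (gcd[m,n]≢0 (m * suc d) (suc d) (inj₂ λ ()))

foldr-fromℕ : ∀ L (f : ℕ → ℕ) (q : ℕ → ℚ) (a : ℕ → ℕ) → (∀ j → j < L → q (f j) ≡ fromℕ (a j)) →
              foldr ℚ._+_ 0ℚ (map q (applyUpTo f L)) ≡ fromℕ (∑< L a)
foldr-fromℕ zero    f q a _  = +m/1≡fromℕ 0
foldr-fromℕ (suc L) f q a eq =
  trans (cong₂ ℚ._+_ (eq 0 (s≤s z≤n)) (foldr-fromℕ L (λ j → f (suc j)) q (λ j → a (suc j)) (λ j j<L → eq (suc j) (s≤s j<L))))
        (fromℕ-+ (a 0) (∑< L (λ j → a (suc j))))

-- n / (n - i) · C(n - i, i) = C(n - i, i) + C(n - i - 1, i - 1)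
lucasWeight : ℕ → ℕ → ℕ
lucasWeight n i = binom (n ∸ i) i + shift (binom (n ∸ i ∸ 1)) i

n*binom≡weight : ∀ n i → i ≤ n → n * binom (n ∸ i) i ≡ lucasWeight n i * (n ∸ i)
n*binom≡weight n i i≤n = begin
  n * B                  ≡⟨ cong (_* B) (m∸n+n≡m i≤n) ⟨
  (n ∸ i + i) * B        ≡⟨ *-distribʳ-+ B (n ∸ i) i ⟩
  (n ∸ i) * B + i * B    ≡⟨ cong (λ e → (n ∸ i) * B + e) (binom-absorb-shift (n ∸ i) i) ⟩
  (n ∸ i) * B + (n ∸ i) * S ≡⟨ *-distribˡ-+ (n ∸ i) B S ⟨
  (n ∸ i) * (B + S)      ≡⟨ *-comm (n ∸ i) (B + S) ⟩
  (B + S) * (n ∸ i)      ∎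
  where
  open ≡-Reasoning
  B S : ℕ
  B = binom (n ∸ i) i
  S = shift (binom (n ∸ i ∸ 1)) i

JLterm-∸suc : ∀ n k i {d} → n ∸ i ≡ suc d → JLterm n k i ≡ ℤ.+ (n * ((n ∸ i) C i) * (i C k)) ℚ./ suc d
JLterm-∸suc n k i eq with n ∸ i in e
JLterm-∸suc n k i refl | .(suc _) rewrite e = refl

JLterm≡fromℕ : ∀ n k i → i < n → JLterm n k i ≡ fromℕ (lucasWeight n i * binom i k)
JLterm≡fromℕ n k i i<n = begin
  JLterm n k i                                              ≡⟨ JLterm-∸suc n k i n∸i≡1+d ⟩
  ℤ.+ (n * ((n ∸ i) C i) * (i C k)) ℚ./ suc d               ≡⟨ cong (λ x → ℤ.+ x ℚ./ suc d) numerator ⟩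
  ℤ.+ (lucasWeight n i * binom i k * suc d) ℚ./ suc d         ≡⟨ +[m*n]/n≡fromℕ (lucasWeight n i * binom i k) d ⟩
  fromℕ (lucasWeight n i * binom i k)                       ∎
  where
  open ≡-Reasoning
  d : ℕ
  d = n ∸ suc i
  n∸i≡1+d : n ∸ i ≡ suc d
  n∸i≡1+d = +-∸-assoc 1 i<n
  swap : ∀ a b c → a * b * c ≡ a * c * b
  swap = solve-∀
  numerator : n * ((n ∸ i) C i) * (i C k) ≡ lucasWeight n i * binom i k * suc d
  numerator = begin
    n * ((n ∸ i) C i) * (i C k)              ≡⟨ cong₂ (λ a b → n * a * b) (C≡binom (n ∸ i) i) (C≡binom i k) ⟩
    n * binom (n ∸ i) i * binom i k          ≡⟨ cong (_* binom i k) (n*binom≡weight n i (<⇒≤ i<n)) ⟩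
    lucasWeight n i * (n ∸ i) * binom i k    ≡⟨ cong (λ x → lucasWeight n i * x * binom i k) n∸i≡1+d ⟩
    lucasWeight n i * suc d * binom i k      ≡⟨ swap (lucasWeight n i) (suc d) (binom i k) ⟩
    lucasWeight n i * binom i k * suc d      ∎

lucas-as-sum : ∀ m k → ∑< (3 + m) (λ i → lucasWeight (2 + m) i * binom i k) ≡ lucas (2 + m) k
lucas-as-sum m k = begin
  ∑< (3 + m) (λ i → lucasWeight (2 + m) i * binom i k)
    ≡⟨ ∑<-cong (3 + m) (λ i _ → *-distribʳ-+ (binom i k) (binom (2 + m ∸ i) i) (shift (binom (2 + m ∸ i ∸ 1)) i)) ⟩
  ∑< (3 + m) (λ i → binom (2 + m ∸ i) i * binom i k + shift (binom (2 + m ∸ i ∸ 1)) i * binom i k)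
    ≡⟨ ∑<-distrib-+ (3 + m) (λ i → binom (2 + m ∸ i) i * binom i k) (λ i → shift (binom (2 + m ∸ i ∸ 1)) i * binom i k) ⟩
  U (2 + m) k + ∑< (2 + m) (λ j → binom (suc m ∸ j ∸ 1) j * binom (suc j) k)
    ≡⟨ cong (λ e → U (2 + m) k + e) (∑<-cong (2 + m) (λ j _ → cong (λ a → binom a j * binom (suc j) k) (suc∸∸1 m j))) ⟩
  U (2 + m) k + ∑< (2 + m) (λ j → binom (m ∸ j) j * binom (suc j) k)
    ≡⟨ cong (λ e → U (2 + m) k + e) (∑-binom-suc m k) ⟩
  U (2 + m) k + (U m k + shift (U m) k)
    ≡⟨ +-assoc (U (2 + m) k) (U m k) (shift (U m) k) ⟨
  lucas (2 + m) k
    ∎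
  where
  open ≡-Reasoning
  suc∸∸1 : ∀ m j → suc m ∸ j ∸ 1 ≡ m ∸ j
  suc∸∸1 m j = trans (∸-+-assoc (suc m) j 1) (cong (suc m ∸_) (+-comm j 1))

lucasWeight-≡0 : ∀ n i → n < i + i → 1 < i → lucasWeight n i ≡ 0
lucasWeight-≡0 n (suc zero)    _    (s≤s ())
lucasWeight-≡0 n (suc (suc i)) n<2i _ =
  cong₂ _+_ (binom-≡0 n∸i<i) (binom-≡0 (∸1-< n∸i<i (s≤s z≤n)))
  where
  n∸i<i : n ∸ suc (suc i) < suc (suc i)
  n∸i<i = ∸-<-half n<2i

JL≡lucas : ∀ n k → 2 ≤ n → k ≤ n / 2 → JL n k ≡ fromℕ (lucas n k)
JL≡lucas (suc zero)      _ (s≤s ()) _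
JL≡lucas n@(suc (suc m)) k 2≤n k≤n/2 = begin
  JL n k                            ≡⟨ foldr-fromℕ L (λ j → j) (λ j → JLterm n k (k + j)) (λ j → t (k + j)) term ⟩
  fromℕ (∑< L (λ j → t (k + j)))    ≡⟨ cong fromℕ sum ⟩
  fromℕ (lucas n k)                 ∎
  where
  open ≡-Reasoning
  t : ℕ → ℕ
  t i = lucasWeight n i * binom i k
  L : ℕ
  L = suc (n / 2) ∸ k
  k+L≡ : k + L ≡ suc (n / 2)
  k+L≡ = m+[n∸m]≡n (m≤n⇒m≤1+n k≤n/2)
  term : ∀ j → j < L → JLterm n k (k + j) ≡ fromℕ (t (k + j))
  term j j<L = JLterm≡fromℕ n k (k + j) (<-≤-trans k+j<1+n/2 (m/n<m n 2 (s≤s (s≤s z≤n))))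
    where
    k+j<1+n/2 : k + j < suc (n / 2)
    k+j<1+n/2 = subst (k + j <_) k+L≡ (+-monoʳ-< k j<L)
  below : ∀ i → i < k → t i ≡ 0
  below i i<k = trans (cong (lucasWeight n i *_) (binom-≡0 i<k)) (*-zeroʳ (lucasWeight n i))
  above : ∀ i → suc (n / 2) ≤ i → t i ≡ 0
  above i n/2<i = cong (_* binom i k) (lucasWeight-≡0 n i (half-< n i n/2<i) (≤-<-trans (/-monoˡ-≤ 2 2≤n) n/2<i))
  sum : ∑< L (λ j → t (k + j)) ≡ lucas n k
  sum = begin
    ∑< L (λ j → t (k + j))               ≡⟨ ∑<-skip-zeros k L t below ⟨
    ∑< (k + L) t                         ≡⟨ cong (λ l → ∑< l t) k+L≡ ⟩
    ∑< (suc (n / 2)) t                   ≡⟨ ∑<-pad-zeros (suc (n / 2)) (n ∸ n / 2) t above ⟨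
    ∑< (suc (n / 2) + (n ∸ n / 2)) t     ≡⟨ cong (λ l → ∑< (suc l) t) (m+[n∸m]≡n (m/n≤m n 2)) ⟩
    ∑< (suc n) t                         ≡⟨ lucas-as-sum m k ⟩
    lucas n k                            ∎

below-mode : ∀ n k → 4 ≤ n → k < (n ∸ 4) / 6 + 1 → 4 + k * 6 ≤ n
below-mode n k 4≤n k<mode =
  subst (4 + k * 6 ≤_) (m+[n∸m]≡n 4≤n) (+-monoʳ-≤ 4 (≤-trans (*-monoˡ-≤ 6 k≤) (m/n*n≤m (n ∸ 4) 6)))
  where
  k≤ : k ≤ (n ∸ 4) / 6
  k≤ = m<1+n⇒m≤n (subst (k <_) (+-comm ((n ∸ 4) / 6) 1) k<mode)

below-half : ∀ n k → 4 + k * 6 ≤ n → k < n / 2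
below-half n k 4+6k≤n = subst (_≤ n / 2) (m*n/n≡m (suc k) 2) (/-monoˡ-≤ 2 (≤-trans 2+2k≤4+6k 4+6k≤n))
  where
  2+2k≤4+6k : suc k * 2 ≤ 4 + k * 6
  2+2k≤4+6k = +-mono-≤ (s≤s (s≤s z≤n)) (*-monoʳ-≤ k (s≤s (s≤s z≤n)))

theorem3p1 : (n : ℕ) → 4 ≤ n → (k : ℕ) → k < ((n ∸ 4) / 6) + 1 →
    JL n k <ℚ JL n (k + 1)
theorem3p1 n 4≤n k k<mode = begin-strict
  JL n k                   ≡⟨ JL≡lucas n k 2≤n (<⇒≤ k<n/2) ⟩
  fromℕ (lucas n k)        <⟨ fromℕ-< (lucas-< n k 4+6k≤n) ⟩
  fromℕ (lucas n (suc k))  ≡⟨ JL≡lucas n (suc k) 2≤n k<n/2 ⟨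
  JL n (suc k)             ≡⟨ cong (JL n) (+-comm 1 k) ⟩
  JL n (k + 1)             ∎
  where
  open ℚ.≤-Reasoning
  4+6k≤n : 4 + k * 6 ≤ n
  4+6k≤n = below-mode n k 4≤n k<mode
  2≤n : 2 ≤ n
  2≤n = ≤-trans (s≤s (s≤s z≤n)) 4≤n
  k<n/2 : k < n / 2
  k<n/2 = below-half n k 4+6k≤n
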